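{- Let $G$ be a graph, $M$ a maximum matching of $G$, and $(H,H')\in M_2(G,M)$. Then every vertex lying on a path from $MP_o^M(M,H)$ is incident to an edge of $H'$.
   Context: Graphs are finite, simple. A matching is a set of pairwise non-adjacent edges. $B_2(G)$ is the set of ordered pairs $(H,H')$ of disjoint matchings; $\lambda(G)=\max\{|H|+|H'|:(H,H')\in B_2(G)\}$; $\alpha(G)=\max\{\max(|H|,|H'|):(H,H')\in B_2(G), |H|+|H'|=\lambda(G)\}$; $M_2(G)=\{(H,H')\in B_2(G):|H|+|H'|=\lambda(G), |H|=\alpha(G)\}$. For a fixed maximum matching $M$, $M_2(G,M)$ is the set of pairs $(H,H')\in M_2(G)$ maximizing $|M\cap(H\cup H')|$. For matchings $A,B$, an $A$-$B$ alternating trail has edges alternately in $A\setminus B$ and $B\setminus A$ (it is a path or an even simple cycle); an $A$-$B$ alternating path is maximal if it is not a proper subtrail of another $A$-$B$ alternating trail. $MP_o^A(A,B)$ is the set of maximal $A$-$B$ alternating paths of odd length whose first (and last) edge lies in $A$. -}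

module Defs where

open import Data.Nat using (ℕ; zero; suc; _+_; _≤_; _<_)
open import Data.Fin using (Fin; toℕ; inject₁; fromℕ)
open import Data.Fin.Subset using (Subset; _∈_; _∉_; _∩_; _∪_; ∣_∣)
open import Data.Product using (Σ; ∃; ∃-syntax; _×_; _,_; proj₁; proj₂)
open import Data.Sum using (_⊎_)
open import Relation.Nullary using (¬_)
open import Data.Empty using (⊥)
open import Relation.Binary.PropositionalEquality using (_≡_; _≢_)

-- A finite simple graph with vertex set Fin n and edge set Fin m;
-- edge e has endpoints ends e (an unordered pair, stored in some order).
record Graph (n m : ℕ) : Set where
  field
    ends     : Fin m → Fin n × Fin n
    loopless : ∀ e → proj₁ (ends e) ≢ proj₂ (ends e)
    simple   : ∀ e f →
               (ends e ≡ ends f ⊎ (proj₁ (ends e) ≡ proj₂ (ends f) × proj₂ (ends e) ≡ proj₁ (ends f))) →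
               e ≡ f
open Graph public

module _ {n m : ℕ} (G : Graph n m) where

  Incident : Fin n → Fin m → Set
  Incident v e = v ≡ proj₁ (ends G e) ⊎ v ≡ proj₂ (ends G e)

  Joins : Fin m → Fin n → Fin n → Set
  Joins e u v = ends G e ≡ (u , v) ⊎ ends G e ≡ (v , u)

  IsMatching : Subset m → Set
  IsMatching A = ∀ e f → e ∈ A → f ∈ A → e ≢ f → ∀ v → Incident v e → Incident v f → ⊥

  IsMaximumMatching : Subset m → Set
  IsMaximumMatching M = IsMatching M × (∀ K → IsMatching K → ∣ K ∣ ≤ ∣ M ∣)

  Disjoint : Subset m → Subset m → Set
  Disjoint A B = ∀ e → e ∈ A → e ∈ B → ⊥

  InB2 : Subset m → Subset m → Set
  InB2 H H' = IsMatching H × IsMatching H' × Disjoint H H'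

  -- (H , H') ∈ M₂(G): |H|+|H'| = λ(G) and |H| = α(G)
  InM2 : Subset m → Subset m → Set
  InM2 H H' =
    InB2 H H' ×
    (∀ K K' → InB2 K K' → ∣ K ∣ + ∣ K' ∣ ≤ ∣ H ∣ + ∣ H' ∣) ×
    (∀ K K' → InB2 K K' → ∣ K ∣ + ∣ K' ∣ ≡ ∣ H ∣ + ∣ H' ∣ → ∣ K ∣ ≤ ∣ H ∣ × ∣ K' ∣ ≤ ∣ H ∣)

  InM2M : Subset m → Subset m → Subset m → Set
  InM2M M H H' =
    InM2 H H' ×
    (∀ K K' → InM2 K K' → ∣ M ∩ (K ∪ K') ∣ ≤ ∣ M ∩ (H ∪ H') ∣)

  record Walk : Set where
    field
      len   : ℕ
      vtx   : Fin (suc len) → Fin n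
      edg   : Fin len → Fin m
      joins : ∀ i → Joins (edg i) (vtx (inject₁ i)) (vtx (Fin.suc i))
  open Walk public

  IsAltWalk : Subset m → Subset m → Walk → Set
  IsAltWalk A B W =
    (∀ i → (edg W i ∈ A × edg W i ∉ B) ⊎ (edg W i ∈ B × edg W i ∉ A)) ×
    (∀ i j → suc (toℕ i) ≡ toℕ j →
       ¬ (edg W i ∈ A × edg W j ∈ A) × ¬ (edg W i ∈ B × edg W j ∈ B))

  IsPath : Walk → Set
  IsPath W = ∀ i j → vtx W i ≡ vtx W j → i ≡ j

  Even : ℕ → Set
  Even k = ∃[ j ] k ≡ j + j

  Odd : ℕ → Set
  Odd k = ∃[ j ] k ≡ suc (j + j)

  IsEvenCycle : Walk → Set
  IsEvenCycle W =
    0 < len W × Even (len W) × vtx W Fin.zero ≡ vtx W (fromℕ (len W)) ×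
    (∀ i j → vtx W (inject₁ i) ≡ vtx W (inject₁ j) → i ≡ j)

  IsAltTrail : Subset m → Subset m → Walk → Set
  IsAltTrail A B W = IsAltWalk A B W × (IsPath W ⊎ IsEvenCycle W)

  EdgeOf : Walk → Fin m → Set
  EdgeOf W e = ∃[ i ] edg W i ≡ e

  ProperSubtrail : Walk → Walk → Set
  ProperSubtrail P T = (∀ e → EdgeOf P e → EdgeOf T e) × (∃[ e ] EdgeOf T e × ¬ EdgeOf P e)

  IsMaximalAltPath : Subset m → Subset m → Walk → Set
  IsMaximalAltPath A B P =
    IsAltWalk A B P × IsPath P × (∀ T → IsAltTrail A B T → ¬ ProperSubtrail P T)

  InMPoA : Subset m → Subset m → Walk → Set
  InMPoA A B P =
    IsMaximalAltPath A B P × Odd (len P) × (∀ i → toℕ i ≡ 0 → edg P i ∈ A)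

module Submission where

open import Defs
open import Data.Nat using (ℕ)
open import Data.Fin using (Fin)
open import Data.Fin.Subset using (Subset; _∈_)
open import Data.Product using (∃-syntax; _×_)

open import Data.Nat using (zero; suc; _+_; _≤_)
open import Data.Nat.Properties using (+-suc; suc-injective; +-cancelˡ-≤; ≤-antisym; <⇒≱)
open import Data.Fin using (toℕ; inject₁; lower₁) renaming (zero to fzero; suc to fsuc)
open import Data.Fin.Properties using (any?; toℕ-inject₁; toℕ-lower₁; inject₁-lower₁)
  renaming (_≟_ to _≟ᶠ_)
open import Data.Fin.Subset
  using (_∉_; _⊆_; _⊂_; _∩_; _∪_; _─_; _-_; ⁅_⁆; ∣_∣; inside; outside)
open import Data.Fin.Subset.Properties
  using ( _∈?_; p─⊥≡p; p─q⊆p; x∈p∪q⁺; x∈p∪q⁻; x∈p∩q⁺; x∈p∩q⁻; x∈⁅x⁆; x∈⁅y⁆⇒x≡y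
        ; x∈p∧x≢y⇒x∈p-y; p⊂q⇒∣p∣<∣q∣ )
open import Data.Vec.Base using (_∷_; here; there)
open import Data.Product using (Σ-syntax; _,_; proj₁; proj₂)
open import Data.Sum using (_⊎_; inj₁; inj₂; [_,_]′)
open import Data.Empty using (⊥; ⊥-elim)
open import Relation.Nullary using (¬_; Dec; yes; no)
open import Relation.Nullary.Decidable using (_×-dec_; _⊎-dec_)
open import Relation.Binary.PropositionalEquality
  using (_≡_; _≢_; refl; sym; trans; cong; subst)

-- Along an M-H alternating walk whose first edge is in M the
--   edges with even index lie in M∖H.  If the walk has odd length, every
--   vertex is an end of an even-indexed edge (vertex 2j and 2j+1 are the ends
--   of edge 2j), so every vertex is incident to an edge of M∖H.
-- * Matching part.  If (H,H') ∈ M₂(G,M) and f ∈ M∖H, then both ends of f are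
--   covered by H'.  Suppose an end v of f is not covered, and let w be the
--   other end.  If w is not covered either, H' + f is a matching disjoint
--   from H, contradicting the maximality of |H|+|H'| = λ(G).  If w is covered
--   by g ∈ H' (so g ∉ M), then H' - g + f has the same size, (H, H' - g + f)
--   is still in M₂(G), and it has one more edge of M: this contradicts the
--   choice of (H,H') in M₂(G,M).

x∈p─q⇒x∉q : ∀ {k} {x : Fin k} (p q : Subset k) → x ∈ p ─ q → x ∉ q
x∈p─q⇒x∉q (s ∷ p) (outside ∷ q) here ()
x∈p─q⇒x∉q (s ∷ p) (t ∷ q) (there x∈p─q) (there x∈q) = x∈p─q⇒x∉q p q x∈p─q x∈q

∣p∣≡1+∣p-x∣ : ∀ {k} {x : Fin k} {p : Subset k} → x ∈ p → ∣ p ∣ ≡ suc ∣ p - x ∣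
∣p∣≡1+∣p-x∣ {x = fzero}  {inside ∷ p}  here        = cong suc (cong ∣_∣ (sym (p─⊥≡p p)))
∣p∣≡1+∣p-x∣ {x = fsuc x} {inside ∷ p}  (there x∈p) = cong suc (∣p∣≡1+∣p-x∣ x∈p)
∣p∣≡1+∣p-x∣ {x = fsuc x} {outside ∷ p} (there x∈p) = ∣p∣≡1+∣p-x∣ x∈p

⊂-insert : ∀ {k} {x : Fin k} {p : Subset k} → x ∉ p → p ⊂ p ∪ ⁅ x ⁆
⊂-insert {x = x} x∉p = (λ y∈p → x∈p∪q⁺ (inj₁ y∈p)) , x , x∈p∪q⁺ (inj₂ (x∈⁅x⁆ x)) , x∉p

parity : ∀ t → ∃[ j ] (t ≡ j + j ⊎ t ≡ suc (j + j))
parity zero = 0 , inj₁ refl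
parity (suc t) with parity t
... | j , inj₁ t≡2j  = j , inj₂ (cong suc t≡2j)
... | j , inj₂ t≡2j+1 = suc j , inj₁ (trans (cong suc t≡2j+1) (cong suc (sym (+-suc j j))))

even≢odd : ∀ j k → j + j ≢ suc (k + k)
even≢odd zero    k ()
even≢odd (suc j) zero    eq rewrite +-suc j j with eq
... | ()
even≢odd (suc j) (suc k) eq rewrite +-suc j j | +-suc k k =
  even≢odd j k (suc-injective (suc-injective eq))

previous : ∀ {k t} (i : Fin k) → toℕ i ≡ suc t → Σ[ i′ ∈ Fin k ] (suc (toℕ i′) ≡ toℕ i × toℕ i′ ≡ t)
previous (fsuc i) eq = inject₁ i , cong suc (toℕ-inject₁ i) , trans (toℕ-inject₁ i) (suc-injective eq)

module Matchings {n m : ℕ} (G : Graph n m) where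

  Covers : Subset m → Fin n → Set
  Covers K v = ∃[ e ] (e ∈ K × Incident G v e)

  covers? : ∀ K v → Dec (Covers K v)
  covers? K v = any? λ e → (e ∈? K) ×-dec ((v ≟ᶠ proj₁ (ends G e)) ⊎-dec (v ≟ᶠ proj₂ (ends G e)))

  EndsAre : Fin m → Fin n → Fin n → Set
  EndsAre f v w = ∀ u → Incident G u f → u ≡ v ⊎ u ≡ w

  other-end : ∀ {f v} → Incident G v f → ∃[ w ] (Incident G w f × EndsAre f v w)
  other-end {f} (inj₁ v≡a) = proj₂ (ends G f) , inj₂ refl , λ
    { u (inj₁ u≡a) → inj₁ (trans u≡a (sym v≡a)) ; u (inj₂ u≡b) → inj₂ u≡b }
  other-end {f} (inj₂ v≡b) = proj₁ (ends G f) , inj₁ refl , λ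
    { u (inj₁ u≡a) → inj₂ u≡a ; u (inj₂ u≡b) → inj₁ (trans u≡b (sym v≡b)) }

  joins-incident : ∀ {e u v} → Joins G e u v → Incident G u e × Incident G v e
  joins-incident (inj₁ eq) = inj₁ (sym (cong proj₁ eq)) , inj₂ (sym (cong proj₂ eq))
  joins-incident (inj₂ eq) = inj₂ (sym (cong proj₂ eq)) , inj₁ (sym (cong proj₁ eq))

  matching-⊆ : ∀ {A B} → A ⊆ B → IsMatching G B → IsMatching G A
  matching-⊆ A⊆B B-match e f e∈A f∈A = B-match e f (A⊆B e∈A) (A⊆B f∈A)

  matching-extend : ∀ {K f} → IsMatching G K → (∀ v → Incident G v f → ¬ Covers K v) →
                    IsMatching G (K ∪ ⁅ f ⁆)
  matching-extend {K} {f} K-match free e e′ e∈ e′∈ e≢e′ v ve ve′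
    with x∈p∪q⁻ K ⁅ f ⁆ e∈ | x∈p∪q⁻ K ⁅ f ⁆ e′∈
  ... | inj₁ e∈K | inj₁ e′∈K = K-match e e′ e∈K e′∈K e≢e′ v ve ve′
  ... | inj₁ e∈K | inj₂ e′∈f with x∈⁅y⁆⇒x≡y f e′∈f
  ...   | refl = free v ve′ (e , e∈K , ve)
  matching-extend {K} {f} K-match free e e′ e∈ e′∈ e≢e′ v ve ve′
      | inj₂ e∈f | inj₁ e′∈K with x∈⁅y⁆⇒x≡y f e∈f
  ...   | refl = free v ve (e′ , e′∈K , ve′)
  matching-extend {K} {f} K-match free e e′ e∈ e′∈ e≢e′ v ve ve′
      | inj₂ e∈f | inj₂ e′∈f = e≢e′ (trans (x∈⁅y⁆⇒x≡y f e∈f) (sym (x∈⁅y⁆⇒x≡y f e′∈f)))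

  disjoint-extend : ∀ {H K f} → Disjoint G H K → f ∉ H → Disjoint G H (K ∪ ⁅ f ⁆)
  disjoint-extend {H} {K} {f} H∩K f∉H e e∈H e∈ with x∈p∪q⁻ K ⁅ f ⁆ e∈
  ... | inj₁ e∈K = H∩K e e∈H e∈K
  ... | inj₂ e∈f with x∈⁅y⁆⇒x≡y f e∈f
  ...   | refl = f∉H e∈H

  removal-uncovers : ∀ {K g w} → IsMatching G K → g ∈ K → Incident G w g → ¬ Covers (K - g) w
  removal-uncovers {K} {g} K-match g∈K wg (e , e∈K-g , we) =
    K-match e g (p─q⊆p K ⁅ g ⁆ e∈K-g) g∈K e≢g _ we wg
    where
    e≢g : e ≢ g
    e≢g refl = x∈p─q⇒x∉q K ⁅ g ⁆ e∈K-g (x∈⁅x⁆ g)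

module AlternatingWalk {n m : ℕ} (G : Graph n m) (A B : Subset m) (W : Walk G)
  (alt : IsAltWalk G A B W) (first : ∀ i → toℕ i ≡ 0 → edg W i ∈ A) where

  open Matchings G using (joins-incident)

  in-A∖B : ∀ i → edg W i ∈ A → edg W i ∈ A × edg W i ∉ B
  in-A∖B i iA with proj₁ alt i
  ... | inj₁ i∈A∖B      = i∈A∖B
  ... | inj₂ (_ , i∉A) = ⊥-elim (i∉A iA)

  after-A : ∀ {i j} → suc (toℕ i) ≡ toℕ j → edg W i ∈ A → edg W j ∈ B
  after-A {i} {j} ij iA with proj₁ alt j
  ... | inj₁ (jA , _) = ⊥-elim (proj₁ (proj₂ alt i j ij) (iA , jA))
  ... | inj₂ (jB , _) = jB

  after-B : ∀ {i j} → suc (toℕ i) ≡ toℕ j → edg W i ∈ B → edg W j ∈ A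
  after-B {i} {j} ij iB with proj₁ alt j
  ... | inj₁ (jA , _) = jA
  ... | inj₂ (jB , _) = ⊥-elim (proj₂ (proj₂ alt i j ij) (iB , jB))

  even-edges : ∀ j (i : Fin (len W)) → toℕ i ≡ j + j → edg W i ∈ A × edg W i ∉ B
  even-edges zero    i i≡0  = in-A∖B i (first i i≡0)
  even-edges (suc j) i i≡2j+2 with previous i (trans i≡2j+2 (cong suc (+-suc j j)))
  ... | i₁ , i₁→i , i₁≡2j+1 with previous i₁ i₁≡2j+1
  ...   | i₀ , i₀→i₁ , i₀≡2j =
    in-A∖B i (after-B i₁→i (after-A i₀→i₁ (proj₁ (even-edges j i₀ i₀≡2j))))

  -- Vertex 2j is the left end and vertex 2j+1 the right end of edge 2j.
  every-vertex : (∃[ l ] len W ≡ suc (l + l)) →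
                 ∀ v → ∃[ e ] ((e ∈ A × e ∉ B) × Incident G (vtx W v) e)
  every-vertex (l , odd) v with parity (toℕ v)
  ... | j , inj₁ v≡2j = edg W i , even-edges j i (trans (toℕ-lower₁ v not-last) v≡2j) , left-end
    where
    not-last : len W ≢ toℕ v
    not-last eq = even≢odd j l (trans (sym v≡2j) (trans (sym eq) odd))
    i : Fin (len W)
    i = lower₁ v not-last
    left-end : Incident G (vtx W v) (edg W i)
    left-end = subst (λ u → Incident G (vtx W u) (edg W i)) (inject₁-lower₁ v not-last)
                     (proj₁ (joins-incident (joins W i)))
  every-vertex (l , odd) (fsuc i) | j , inj₂ v≡2j+1 =
    edg W i , even-edges j i (suc-injective v≡2j+1) , proj₂ (joins-incident (joins W i))

module Exchange {n m : ℕ} (G : Graph n m) (M H H' : Subset m)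
  (M-match : IsMatching G M) (chosen : InM2M G M H H') where

  open Matchings G

  private
    in-M₂ : InM2 G H H'
    in-M₂ = proj₁ chosen
    H-match : IsMatching G H
    H-match = proj₁ (proj₁ in-M₂)
    H'-match : IsMatching G H'
    H'-match = proj₁ (proj₂ (proj₁ in-M₂))
    H∩H' : Disjoint G H H'
    H∩H' = proj₂ (proj₂ (proj₁ in-M₂))
    λ-max : ∀ K K′ → InB2 G K K′ → ∣ K ∣ + ∣ K′ ∣ ≤ ∣ H ∣ + ∣ H' ∣
    λ-max = proj₁ (proj₂ in-M₂)

  replace-in-M₂ : ∀ {K′} → InB2 G H K′ → ∣ K′ ∣ ≡ ∣ H' ∣ → InM2 G H K′
  replace-in-M₂ {K′} b₂ same = b₂
    , (λ K K″ b → subst (λ s → ∣ K ∣ + ∣ K″ ∣ ≤ ∣ H ∣ + s) (sym same) (λ-max K K″ b))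
    , (λ K K″ b eq → proj₂ (proj₂ in-M₂) K K″ b (trans eq (cong (∣ H ∣ +_) same)))

  companion-bound : ∀ {K′} → InB2 G H K′ → ∣ K′ ∣ ≤ ∣ H' ∣
  companion-bound {K′} b₂ = +-cancelˡ-≤ ∣ H ∣ _ _ (λ-max H K′ b₂)

  -- If neither end of f ∉ H is covered by H', then H' + f beats λ(G).
  no-augmentation : ∀ {f} → f ∉ H → (∀ v → Incident G v f → ¬ Covers H' v) → ⊥
  no-augmentation {f} f∉H free = <⇒≱ (p⊂q⇒∣p∣<∣q∣ (⊂-insert f∉H')) (companion-bound b₂)
    where
    f∉H' : f ∉ H'
    f∉H' f∈H' = free _ (inj₁ refl) (f , f∈H' , inj₁ refl)
    b₂ : InB2 G H (H' ∪ ⁅ f ⁆)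
    b₂ = H-match , matching-extend H'-match free , disjoint-extend H∩H' f∉H

  -- Exchanging g ∈ H'∖M for f ∈ M∖(H ∪ H') keeps (H , ·) in M₂(G) and
  -- gains an edge of M, contradicting the choice of (H , H') in M₂(G,M).
  no-exchange : ∀ {f g} → f ∈ M → f ∉ H → f ∉ H' → g ∈ H' → g ∉ M →
                (∀ v → Incident G v f → ¬ Covers (H' - g) v) → ⊥
  no-exchange {f} {g} f∈M f∉H f∉H' g∈H' g∉M free =
    <⇒≱ (p⊂q⇒∣p∣<∣q∣ more-of-M) (proj₂ chosen H K′ (replace-in-M₂ b₂ same-size))
    where
    K′ : Subset m
    K′ = (H' - g) ∪ ⁅ f ⁆
    H'-g⊆H' : H' - g ⊆ H'
    H'-g⊆H' = p─q⊆p H' ⁅ g ⁆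
    b₂ : InB2 G H K′
    b₂ = H-match , matching-extend (matching-⊆ H'-g⊆H' H'-match) free
                 , disjoint-extend (λ e e∈H e∈H'-g → H∩H' e e∈H (H'-g⊆H' e∈H'-g)) f∉H
    -- |H'| = 1 + |H' - g| ≤ |K′| ≤ |H'|
    same-size : ∣ K′ ∣ ≡ ∣ H' ∣
    same-size = ≤-antisym (companion-bound b₂)
      (subst (_≤ ∣ K′ ∣) (sym (∣p∣≡1+∣p-x∣ g∈H'))
             (p⊂q⇒∣p∣<∣q∣ (⊂-insert (λ f∈H'-g → f∉H' (H'-g⊆H' f∈H'-g)))))
    keeps-M : M ∩ (H ∪ H') ⊆ M ∩ (H ∪ K′)
    keeps-M {e} e∈ with x∈p∩q⁻ M (H ∪ H') e∈
    ... | e∈M , e∈H∪H' with x∈p∪q⁻ H H' e∈H∪H'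
    ...   | inj₁ e∈H  = x∈p∩q⁺ (e∈M , x∈p∪q⁺ (inj₁ e∈H))
    ...   | inj₂ e∈H' = x∈p∩q⁺ (e∈M , x∈p∪q⁺ (inj₂ (x∈p∪q⁺ (inj₁ (x∈p∧x≢y⇒x∈p-y e∈H' e≢g)))))
      where
      e≢g : e ≢ g
      e≢g refl = g∉M e∈M
    more-of-M : M ∩ (H ∪ H') ⊂ M ∩ (H ∪ K′)
    more-of-M = keeps-M , f , x∈p∩q⁺ (f∈M , x∈p∪q⁺ (inj₂ (x∈p∪q⁺ (inj₂ (x∈⁅x⁆ f)))))
              , λ f∈ → [ f∉H , f∉H' ]′ (x∈p∪q⁻ H H' (proj₂ (x∈p∩q⁻ M (H ∪ H') f∈)))

  ends-covered : ∀ {f v} → f ∈ M → f ∉ H → Incident G v f → Covers H' v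
  ends-covered {f} {v} f∈M f∉H vf with covers? H' v
  ... | yes covered = covered
  ... | no v-free with other-end vf
  ...   | w , wf , ends-vw with covers? H' w
  ...     | no w-free = ⊥-elim (no-augmentation f∉H free)
    where
    free : ∀ u → Incident G u f → ¬ Covers H' u
    free u uf with ends-vw u uf
    ... | inj₁ refl = v-free
    ... | inj₂ refl = w-free
  ...     | yes (g , g∈H' , wg) = ⊥-elim (no-exchange f∈M f∉H f∉H' g∈H' g∉M free)
    where
    f∉H' : f ∉ H'
    f∉H' f∈H' = v-free (f , f∈H' , vf)
    g∉M : g ∉ M
    g∉M g∈M = M-match g f g∈M f∈M (λ { refl → f∉H' g∈H' }) w wg wf
    free : ∀ u → Incident G u f → ¬ Covers (H' - g) u
    free u uf with ends-vw u uf
    ... | inj₁ refl = λ (e , e∈ , ue) → v-free (e , p─q⊆p H' ⁅ g ⁆ e∈ , ue)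
    ... | inj₂ refl = removal-uncovers H'-match g∈H' wg

-- Every vertex of the path is an end of an edge f ∈ M∖H of the path,
-- and the ends of such an edge are covered by H'.
lemma3p2 : ∀ {n m} (G : Graph n m) (M H H' : Subset m) →
    IsMaximumMatching G M → InM2M G M H H' →
    ∀ (P : Walk G) → InMPoA G M H P →
    ∀ (i : Fin (ℕ.suc (len P))) → ∃[ e ] (e ∈ H' × Incident G (vtx P i) e)
lemma3p2 G M H H' (M-match , _) chosen P ((alt , _ , _) , odd , first) i
  with AlternatingWalk.every-vertex G M H P alt first odd i
... | f , (f∈M , f∉H) , vf = Exchange.ends-covered G M H H' M-match chosen f∈M f∉H vf
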